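{- Let $n\ge 0$ be an integer. Then (i) for all $k\ge0$, $s_{n+f_{2k}}\ne s_n$ if and only if $\Phi_k(n)\in\{\frac{f_{2k+1}}{2},\frac{f_{2k+1}}{2}-1\}$; (ii) for all $k\ge1$, $s_{n+f_{2k+1}}\ne s_n$ if and only if $\Phi_k(n)\in\{\frac{f_{2k+3}}{2},\frac{f_{2k+3}}{2}-1,\frac{f_{2k+3}}{2}+f_{2k},\frac{f_{2k+3}}{2}+f_{2k}-1\}$.
   Context: Let $\tau$ be the substitution on $\{0,1\}$ with $\tau(1)=101$, $\tau(0)=1$ (extended to words by concatenation), and let $\mathbf{s}=(s_j)_{j\ge 0}=\lim_{j\to\infty}\tau^j(1)$ be its fixed point beginning with $1$. Define $f_{2j}=|\tau^j(1)|$, $f_{2j+1}=|\tau^j(10)|$ ($|w|$ = length of $w$); equivalently $f_0=1$, $f_1=2$, $f_{2j+2}=f_{2j}+f_{2j+1}$, $f_{2j+3}=f_{2j}+f_{2j+2}$; the $f_{2j+1}$ are even. Every integer $n\ge0$ has a unique representation $n=\sum_{i\ge0}a_i(n)f_i$ with $a_i(n)\in\{0,1\}$, finitely many nonzero, $a_ia_{i+1}=0$ for all $i$, and $a_ia_{i+2}=0$ for all even $i$. For $k\ge0$ the truncated $f$-representation is $\Phi_k(n)=\sum_{i=0}^{2k+2}a_i(n)f_i$. -}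

module Defs where

open import Data.Nat using (ℕ; zero; suc; _+_; _*_; _≤_; _<_)
open import Data.Bool using (Bool; true; false; _∧_)
open import Data.List using (List; []; _∷_; _++_; concatMap; length)
open import Data.Product using (_×_)
open import Relation.Binary.PropositionalEquality using (_≡_)

-- Letters 0,1 are encoded as false,true.
-- The substitution τ : τ(1) = 101, τ(0) = 1, extended to words.
τ₁ : Bool → List Bool
τ₁ true  = true ∷ false ∷ true ∷ []
τ₁ false = true ∷ []

τ : List Bool → List Bool
τ = concatMap τ₁

τ^ : ℕ → List Bool → List Bool
τ^ zero    w = w
τ^ (suc j) w = τ (τ^ j w)

-- i-th letter of a word (default 0 out of range; never used out of range below)
at : List Bool → ℕ → Bool
at []       _       = false
at (x ∷ _)  zero    = x
at (_ ∷ xs) (suc i) = at xs i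

-- The fixed point s = lim τ^j(1).  Since τ^j(1) is a prefix of τ^(j+1)(1)
-- and |τ^(j+1)(1)| > j, the j-th letter of s is the j-th letter of τ^(j+1)(1).
s : ℕ → Bool
s j = at (τ^ (suc j) (true ∷ [])) j

half : ℕ → ℕ
half zero          = zero
half (suc zero)    = zero
half (suc (suc m)) = suc (half m)

isEven : ℕ → Bool
isEven zero          = true
isEven (suc zero)    = false
isEven (suc (suc m)) = isEven m

fAux : Bool → ℕ → ℕ
fAux true  j = length (τ^ j (true ∷ []))
fAux false j = length (τ^ j (true ∷ false ∷ []))

f : ℕ → ℕ
f i = fAux (isEven i) (half i)

-- Digit sequences a_0 a_1 a_2 ... given as a finite list (digits beyond the list are 0).
digit : List Bool → ℕ → Bool
digit = at

val-from : ℕ → List Bool → ℕ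
val-from i₀ []           = 0
val-from i₀ (true ∷ ds)  = f i₀ + val-from (suc i₀) ds
val-from i₀ (false ∷ ds) = val-from (suc i₀) ds

value : List Bool → ℕ
value = val-from 0

Admissible : List Bool → Set
Admissible a = ∀ i → (digit a i ∧ digit a (suc i) ≡ false)
                   × (isEven i ≡ true → digit a i ∧ digit a (suc (suc i)) ≡ false)

IsFRep : ℕ → List Bool → Set
IsFRep n a = (value a ≡ n) × Admissible a

partial : ℕ → List Bool → ℕ
partial zero    a = 0
partial (suc m) a = partial m a + (if′ (digit a m))
  where
  if′ : Bool → ℕ
  if′ true  = f m
  if′ false = 0

Φ : ℕ → List Bool → ℕ
Φ k a = partial (3 + 2 * k) a

module Submission where

-- Write w₁ j = τʲ(1) and w₀ j = τʲ(0), so that w₁ (j+1) = w₁ j w₀ j w₁ j and s begins with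
-- every w₁ j.  The words w₁ j w₀ j and w₀ j w₁ j differ exactly in their two middle letters,
-- at mid j and mid j + 1, where 2 (mid j + 1) = f_{2j+1}.  Reading w₁ (k+2) from 0 and from
-- f_{2k} (resp. f_{2k+1}) block by block compares s with its shift on [0, f_{2k+3}) and finds
-- exactly the mismatches listed in (i) (resp. (ii)).  The same comparison makes each f_i a
-- period of s on an initial segment, and the high part n - Φ_k(n) of an admissible
-- representation inherits a period long enough that s(n + c), s(n) may be replaced by
-- s(Φ_k(n) + c), s(Φ_k(n)); as Φ_k(n) < f_{2k+3}, the comparison above applies.

open import Data.Bool using (Bool; true; false; _∧_; if_then_else_)
open import Data.Bool.Properties using (_≟_; ∧-identityʳ)
open import Data.Empty using (⊥-elim)
open import Data.List using (List; []; _∷_; _++_; length; drop; map)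
open import Data.List.Membership.Propositional using (_∈_; _∉_)
open import Data.List.Membership.Propositional.Properties using (∈-map⁺; ∈-map⁻; ∈-++⁺ˡ; ∈-++⁺ʳ; ∈-++⁻)
open import Data.List.Properties using (++-assoc; ++-identityʳ; length-++; concatMap-++; ++-monoid)
open import Data.List.Relation.Unary.All using (All; []; _∷_)
open import Data.List.Relation.Unary.Any using (here; there)
open import Algebra.Solver.Monoid (++-monoid Bool) using (solve; _⊜_; _⊕_)
open import Data.Nat using (ℕ; zero; suc; _+_; _*_; _∸_; _/_; _≤_; _<_; z≤n; s≤s)
open import Data.Nat.DivMod using (m*n/n≡m)
open import Data.Nat.Properties hiding (_≟_)
open import Data.Nat.Tactic.RingSolver using (solve-∀)
open import Data.Product using (Σ; _×_; _,_; proj₁; proj₂)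
open import Data.Sum using (_⊎_; inj₁; inj₂)
open import Function.Base using (_∘_; case_of_)
open import Function.Bundles using (_⇔_; mk⇔; Equivalence)
open import Function.Properties.Equivalence using () renaming (trans to ⇔-trans)
open import Relation.Binary.PropositionalEquality
open import Relation.Nullary.Decidable using (decidable-stable)

open import Defs

τ^-++ : ∀ j xs ys → τ^ j (xs ++ ys) ≡ τ^ j xs ++ τ^ j ys
τ^-++ zero    xs ys = refl
τ^-++ (suc j) xs ys = trans (cong τ (τ^-++ j xs ys)) (concatMap-++ τ₁ (τ^ j xs) (τ^ j ys))

τ^-suc : ∀ j w → τ^ (suc j) w ≡ τ^ j (τ w)
τ^-suc zero    w = refl
τ^-suc (suc j) w = cong τ (τ^-suc j w)

w₁ w₀ : ℕ → List Bool
w₁ j = τ^ j (true ∷ [])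
w₀ j = τ^ j (false ∷ [])

w₁-suc : ∀ j → w₁ (suc j) ≡ w₁ j ++ w₀ j ++ w₁ j
w₁-suc j = begin
  w₁ (suc j)                        ≡⟨ τ^-suc j (true ∷ []) ⟩
  τ^ j (true ∷ false ∷ true ∷ [])   ≡⟨ τ^-++ j (true ∷ []) (false ∷ true ∷ []) ⟩
  w₁ j ++ τ^ j (false ∷ true ∷ [])  ≡⟨ cong (w₁ j ++_) (τ^-++ j (false ∷ []) (true ∷ [])) ⟩
  w₁ j ++ w₀ j ++ w₁ j              ∎
  where open ≡-Reasoning

w₀-suc : ∀ j → w₀ (suc j) ≡ w₁ j
w₀-suc j = τ^-suc j (false ∷ [])

F F₀ : ℕ → ℕ
F  j = length (w₁ j)
F₀ j = length (w₀ j)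

F-suc : ∀ j → F (suc j) ≡ F j + (F₀ j + F j)
F-suc j = begin
  F (suc j)                      ≡⟨ cong length (w₁-suc j) ⟩
  length (w₁ j ++ w₀ j ++ w₁ j)  ≡⟨ length-++ (w₁ j) ⟩
  F j + length (w₀ j ++ w₁ j)    ≡⟨ cong (F j +_) (length-++ (w₀ j)) ⟩
  F j + (F₀ j + F j)             ∎
  where open ≡-Reasoning

F₀-suc : ∀ j → F₀ (suc j) ≡ F j
F₀-suc j = cong length (w₀-suc j)

mid : ℕ → ℕ
mid zero    = 0
mid (suc j) = F j + mid j

F+F₀≡[1+mid]*2 : ∀ j → F j + F₀ j ≡ suc (mid j) * 2
F+F₀≡[1+mid]*2 zero    = refl
F+F₀≡[1+mid]*2 (suc j) = begin
  F (suc j) + F₀ (suc j)         ≡⟨ cong₂ _+_ (F-suc j) (F₀-suc j) ⟩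
  F j + (F₀ j + F j) + F j       ≡⟨ regroup (F j) (F₀ j) ⟩
  (F j + F₀ j) + (F j + F j)     ≡⟨ cong (_+ (F j + F j)) (F+F₀≡[1+mid]*2 j) ⟩
  suc (mid j) * 2 + (F j + F j)  ≡⟨ collect (F j) (mid j) ⟩
  suc (mid (suc j)) * 2          ∎
  where
  open ≡-Reasoning
  regroup : ∀ p q → p + (q + p) + p ≡ (p + q) + (p + p)
  regroup = solve-∀
  collect : ∀ p q → suc q * 2 + (p + p) ≡ suc (p + q) * 2
  collect = solve-∀

mid<F+F₀ : ∀ j → mid j < F j + F₀ j
mid<F+F₀ j rewrite F+F₀≡[1+mid]*2 j = m≤m*n (suc (mid j)) 2

F+F₀≤F-suc : ∀ j → F j + F₀ j ≤ F (suc j)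
F+F₀≤F-suc j rewrite F-suc j = +-monoʳ-≤ (F j) (m≤m+n (F₀ j) (F j))

j<F : ∀ j → j < F j
j<F zero    = s≤s z≤n
j<F (suc j) = begin-strict
  suc j          ≤⟨ j<F j ⟩
  F j            <⟨ m<m+n (F j) (≤-<-trans z≤n (j<F j)) ⟩
  F j + F j      ≤⟨ +-monoʳ-≤ (F j) (m≤n+m (F j) (F₀ j)) ⟩
  F j + (F₀ j + F j) ≡⟨ F-suc j ⟨
  F (suc j)      ∎
  where open ≤-Reasoning

double : ℕ → ℕ
double zero    = zero
double (suc j) = suc (suc (double j))

double≡2* : ∀ j → double j ≡ 2 * j
double≡2* zero    = refl
double≡2* (suc j) = trans (cong (2 +_) (double≡2* j)) (sym (*-suc 2 j))

isEven-double : ∀ j → isEven (double j) ≡ true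
isEven-double zero    = refl
isEven-double (suc j) = isEven-double j

isEven-suc-double : ∀ j → isEven (suc (double j)) ≡ false
isEven-suc-double zero    = refl
isEven-suc-double (suc j) = isEven-suc-double j

half-double : ∀ j → half (double j) ≡ j
half-double zero    = refl
half-double (suc j) = cong suc (half-double j)

half-suc-double : ∀ j → half (suc (double j)) ≡ j
half-suc-double zero    = refl
half-suc-double (suc j) = cong suc (half-suc-double j)

f-double : ∀ j → f (double j) ≡ F j
f-double j rewrite isEven-double j | half-double j = refl

f-suc-double : ∀ j → f (suc (double j)) ≡ F j + F₀ j
f-suc-double j rewrite isEven-suc-double j | half-suc-double j =
  trans (cong length (τ^-++ j (true ∷ []) (false ∷ []))) (length-++ (w₁ j))

f-2* : ∀ k → f (2 * k) ≡ F k
f-2* k = trans (cong f (sym (double≡2* k))) (f-double k)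

f-2*+1 : ∀ k → f (2 * k + 1) ≡ F k + F₀ k
f-2*+1 k = trans (cong f (trans (+-comm (2 * k) 1) (cong suc (sym (double≡2* k))))) (f-suc-double k)

f-2*+1/2 : ∀ k → f (2 * k + 1) / 2 ≡ suc (mid k)
f-2*+1/2 k = trans (cong (_/ 2) (trans (f-2*+1 k) (F+F₀≡[1+mid]*2 k))) (m*n/n≡m (suc (mid k)) 2)

f-2*+3/2 : ∀ k → f (2 * k + 3) / 2 ≡ suc (mid (suc k))
f-2*+3/2 k = trans (cong (λ i → f i / 2) (index k)) (f-2*+1/2 (suc k))
  where
  index : ∀ k → 2 * k + 3 ≡ 2 * suc k + 1
  index = solve-∀

at-++ˡ : ∀ xs ys {i} → i < length xs → at (xs ++ ys) i ≡ at xs i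
at-++ˡ (_ ∷ xs) ys {zero}  _         = refl
at-++ˡ (_ ∷ xs) ys {suc i} (s≤s i<) = at-++ˡ xs ys i<

at-++ʳ : ∀ xs ys i → at (xs ++ ys) (length xs + i) ≡ at ys i
at-++ʳ []       ys i = refl
at-++ʳ (_ ∷ xs) ys i = at-++ʳ xs ys i

w₁-prefix : ∀ m j → Σ (List Bool) λ r → w₁ (m + j) ≡ w₁ j ++ r
w₁-prefix zero    j = [] , sym (++-identityʳ (w₁ j))
w₁-prefix (suc m) j with w₁-prefix m j
... | r , e = r ++ w₀ (m + j) ++ w₁ (m + j) ,
  trans (w₁-suc (m + j)) (trans (cong (_++ _) e) (++-assoc (w₁ j) r _))

at-w₁-extend : ∀ {j j′ i} → j ≤ j′ → i < F j → at (w₁ j′) i ≡ at (w₁ j) i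
at-w₁-extend {j} {j′} {i} j≤j′ i<F with w₁-prefix (j′ ∸ j) j
... | r , e = begin
  at (w₁ j′) i              ≡⟨ cong (λ t → at (w₁ t) i) (m∸n+n≡m j≤j′) ⟨
  at (w₁ (j′ ∸ j + j)) i    ≡⟨ cong (λ w → at w i) e ⟩
  at (w₁ j ++ r) i          ≡⟨ at-++ˡ (w₁ j) r i<F ⟩
  at (w₁ j) i               ∎
  where open ≡-Reasoning

s-prefix : ∀ j {i} → i < F j → s i ≡ at (w₁ j) i
s-prefix j {i} i<F with ≤-total j (suc i)
... | inj₁ j≤ = at-w₁-extend j≤ i<F
... | inj₂ ≤j = sym (at-w₁-extend ≤j (<-trans (n<1+n i) (j<F (suc i))))

s-factor : ∀ N c {W R} → w₁ N ≡ c ++ W ++ R → ∀ {x} → x < length W → s (length c + x) ≡ at W x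
s-factor N c {W} {R} e {x} x<W = begin
  s (length c + x)                     ≡⟨ s-prefix N (subst (length c + x <_) (sym lengthN) c+x<) ⟩
  at (w₁ N) (length c + x)             ≡⟨ cong (λ w → at w (length c + x)) e ⟩
  at (c ++ W ++ R) (length c + x)      ≡⟨ at-++ʳ c (W ++ R) x ⟩
  at (W ++ R) x                        ≡⟨ at-++ˡ W R x<W ⟩
  at W x                               ∎
  where
  open ≡-Reasoning
  lengthN : F N ≡ length c + (length W + length R)
  lengthN = trans (cong length e) (trans (length-++ c) (cong (length c +_) (length-++ W)))
  c+x< : length c + x < length c + (length W + length R)
  c+x< = +-monoʳ-< (length c) (<-≤-trans x<W (m≤m+n (length W) (length R)))

≢-cong : ∀ {A : Set} {a b c d : A} → a ≡ c → b ≡ d → (a ≢ b) ⇔ (c ≢ d)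
≢-cong refl refl = mk⇔ (λ ne → ne) (λ ne → ne)

data SplitAt (n : ℕ) : ℕ → Set where
  left  : ∀ {i} → i < n → SplitAt n i
  right : ∀ j → SplitAt n (n + j)

splitAt : ∀ n i → SplitAt n i
splitAt zero    i       = right i
splitAt (suc n) zero    = left (s≤s z≤n)
splitAt (suc n) (suc i) with splitAt n i
... | left i<n = left (s≤s i<n)
... | right j  = right j

record DiffersAt (ms : List ℕ) (xs ys : List Bool) : Set where
  field
    length≡    : length xs ≡ length ys
    differs    : ∀ {i} → i ∈ ms → i < length xs × at xs i ≢ at ys i
    exhaustive : ∀ {i} → i < length xs → at xs i ≢ at ys i → i ∈ ms

differsAt-cong : ∀ {ms ms′ xs xs′ ys ys′} → ms ≡ ms′ → xs ≡ xs′ → ys ≡ ys′ →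
  DiffersAt ms xs ys → DiffersAt ms′ xs′ ys′
differsAt-cong refl refl refl D = D

differsAt-refl : ∀ xs → DiffersAt [] xs xs
differsAt-refl xs = record
  { length≡    = refl
  ; differs    = λ ()
  ; exhaustive = λ _ ne → ⊥-elim (ne refl)
  }

differsAt-sym : ∀ {ms xs ys} → DiffersAt ms xs ys → DiffersAt ms ys xs
differsAt-sym D = record
  { length≡    = sym length≡
  ; differs    = λ i∈ → let (i< , ne) = differs i∈ in subst (_ <_) length≡ i< , ne ∘ sym
  ; exhaustive = λ i< ne → exhaustive (subst (_ <_) (sym length≡) i<) (ne ∘ sym)
  }
  where open DiffersAt D

differsAt-++ : ∀ {ms ms′ xs xs′ ys ys′} → DiffersAt ms xs ys → DiffersAt ms′ xs′ ys′ →
  DiffersAt (ms ++ map (length xs +_) ms′) (xs ++ xs′) (ys ++ ys′)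
differsAt-++ {ms} {ms′} {xs} {xs′} {ys} {ys′} D D′ = record
  { length≡    = trans (length-++ xs) (trans (cong₂ _+_ (length≡ D) (length≡ D′)) (sym (length-++ ys)))
  ; differs    = differs′
  ; exhaustive = exhaustive′
  }
  where
  open DiffersAt
  on-left : ∀ {i} → i < length xs → (at (xs ++ xs′) i ≢ at (ys ++ ys′) i) ⇔ (at xs i ≢ at ys i)
  on-left i< = ≢-cong (at-++ˡ xs xs′ i<) (at-++ˡ ys ys′ (subst (_ <_) (length≡ D) i<))
  on-right : ∀ j →
    (at (xs ++ xs′) (length xs + j) ≢ at (ys ++ ys′) (length xs + j)) ⇔ (at xs′ j ≢ at ys′ j)
  on-right j = ≢-cong (at-++ʳ xs xs′ j)
    (trans (cong (λ l → at (ys ++ ys′) (l + j)) (length≡ D)) (at-++ʳ ys ys′ j))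
  length-xs++ : ∀ {i} → i < length (xs ++ xs′) → i < length xs + length xs′
  length-xs++ = subst (_ <_) (length-++ xs)
  differs′ : ∀ {i} → i ∈ ms ++ map (length xs +_) ms′ →
    i < length (xs ++ xs′) × at (xs ++ xs′) i ≢ at (ys ++ ys′) i
  differs′ i∈ with ∈-++⁻ ms i∈
  ... | inj₁ i∈ms = let (i< , ne) = differs D i∈ms in
    subst (_ <_) (sym (length-++ xs)) (<-≤-trans i< (m≤m+n _ _)) , Equivalence.from (on-left i<) ne
  ... | inj₂ i∈map with ∈-map⁻ (length xs +_) i∈map
  ... | j , j∈ , refl = let (j< , ne) = differs D′ j∈ in
    subst (_ <_) (sym (length-++ xs)) (+-monoʳ-< (length xs) j<) , Equivalence.from (on-right j) ne
  exhaustive′ : ∀ {i} → i < length (xs ++ xs′) → at (xs ++ xs′) i ≢ at (ys ++ ys′) i →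
    i ∈ ms ++ map (length xs +_) ms′
  exhaustive′ {i} i< ne with splitAt (length xs) i
  ... | left i<xs = ∈-++⁺ˡ (exhaustive D i<xs (Equivalence.to (on-left i<xs) ne))
  ... | right j   = ∈-++⁺ʳ ms (∈-map⁺ (length xs +_)
    (exhaustive D′ (+-cancelˡ-< (length xs) _ _ (length-xs++ i<)) (Equivalence.to (on-right j) ne)))

w₁w₀-suc : ∀ j → w₁ (suc j) ++ w₀ (suc j) ≡ (w₁ j ++ w₀ j ++ w₁ j) ++ w₁ j
w₁w₀-suc j = cong₂ _++_ (w₁-suc j) (w₀-suc j)

w₁w₀-differsAt : ∀ j → DiffersAt (suc (mid j) ∷ mid j ∷ []) (w₁ j ++ w₀ j) (w₀ j ++ w₁ j)
w₁w₀-differsAt zero = record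
  { length≡    = refl
  ; differs    = λ { (here refl) → s≤s (s≤s z≤n) , λ () ; (there (here refl)) → s≤s z≤n , λ () }
  ; exhaustive = λ { {zero} _ _ → there (here refl) ; {suc zero} _ _ → here refl
                   ; {suc (suc _)} (s≤s (s≤s ())) _ }
  }
w₁w₀-differsAt (suc j) =
  differsAt-cong (cong (λ m → m ∷ mid (suc j) ∷ []) (+-suc (F j) (mid j))) (sym e₁) (sym e₂)
    (differsAt-++ (differsAt-refl u) (differsAt-++ (differsAt-sym (w₁w₀-differsAt j)) (differsAt-refl u)))
  where
  u = w₁ j
  z = w₀ j
  e₁ : w₁ (suc j) ++ w₀ (suc j) ≡ u ++ (z ++ u) ++ u
  e₁ = trans (w₁w₀-suc j) (solve 2 (λ u z → (u ⊕ (z ⊕ u)) ⊕ u ⊜ u ⊕ ((z ⊕ u) ⊕ u)) refl u z)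
  e₂ : w₀ (suc j) ++ w₁ (suc j) ≡ u ++ (u ++ z) ++ u
  e₂ = trans (cong₂ _++_ (w₀-suc j) (w₁-suc j))
    (solve 2 (λ u z → u ⊕ (u ⊕ (z ⊕ u)) ⊜ u ⊕ ((u ⊕ z) ⊕ u)) refl u z)

shift-differsAt : ∀ {N ms W₁ W₂ R₁ R₂} c → DiffersAt ms W₁ W₂ →
  w₁ N ≡ W₁ ++ R₁ → w₁ N ≡ c ++ W₂ ++ R₂ →
  ∀ {x} → x < length W₁ → (s (length c + x) ≢ s x) ⇔ (x ∈ ms)
shift-differsAt {N} {W₁ = W₁} {W₂} {R₁} {R₂} c D e₁ e₂ x< = ⇔-trans
  (≢-cong (s-factor N c {W₂} {R₂} e₂ (subst (_ <_) length≡ x<)) (s-factor N [] {W₁} {R₁} e₁ x<))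
  (mk⇔ (λ ne → exhaustive x< (ne ∘ sym)) (λ x∈ → proj₂ (differs x∈) ∘ sym))
  where open DiffersAt D

shift-F-differsAt : ∀ k {x} → x < F (suc k) + F₀ (suc k) →
  (s (F k + x) ≢ s x) ⇔ (x ∈ suc (mid k) ∷ mid k ∷ [])
shift-F-differsAt k x< = shift-differsAt {N = suc (suc k)} u
  (differsAt-cong refl (sym e₁) refl (differsAt-++ (w₁w₀-differsAt k) (differsAt-refl (u ++ u))))
  (trans (w₁-suc (suc k)) (sym (++-assoc (w₁ (suc k)) (w₀ (suc k)) _)))
  (trans (w₁-suc (suc k)) e₂)
  (subst (_ <_) (sym (length-++ (w₁ (suc k)))) x<)
  where
  u = w₁ k
  z = w₀ k
  e₁ : w₁ (suc k) ++ w₀ (suc k) ≡ (u ++ z) ++ (u ++ u)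
  e₁ = trans (w₁w₀-suc k) (solve 2 (λ u z → (u ⊕ (z ⊕ u)) ⊕ u ⊜ (u ⊕ z) ⊕ (u ⊕ u)) refl u z)
  e₂ : w₁ (suc k) ++ w₀ (suc k) ++ w₁ (suc k) ≡ u ++ ((z ++ u) ++ (u ++ u)) ++ (z ++ u)
  e₂ = trans (cong₂ (λ U V → U ++ V ++ U) (w₁-suc k) (w₀-suc k))
    (solve 2 (λ u z → (u ⊕ (z ⊕ u)) ⊕ (u ⊕ (u ⊕ (z ⊕ u)))
                    ⊜ u ⊕ (((z ⊕ u) ⊕ (u ⊕ u)) ⊕ (z ⊕ u))) refl u z)

shift-F+F₀-differsAt : ∀ k → let K = suc k in ∀ {x} → x < F (suc K) + F₀ (suc K) →
  (s (F K + F₀ K + x) ≢ s x) ⇔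
  (x ∈ suc (mid (suc K)) ∷ mid (suc K) ∷ suc (mid (suc K)) + F K ∷ mid (suc K) + F K ∷ [])
shift-F+F₀-differsAt k {x} x< = ⇔-trans
  (≢-cong (cong (λ l → s (l + x)) (sym (length-++ (w₁ K)))) refl)
  (shift-differsAt {N = suc (suc K)} (u ++ z)
    (differsAt-cong positions (sym (e₁ (w₁-suc K) (w₀-suc K) (w₁-suc k) (w₀-suc k))) refl
      (differsAt-++ (differsAt-refl u)
        (differsAt-++ (differsAt-sym (w₁w₀-differsAt K))
          (differsAt-++ (w₁w₀-differsAt k) (differsAt-refl A)))))
    (trans (w₁-suc (suc K)) (sym (++-assoc (w₁ (suc K)) (w₀ (suc K)) _)))
    (trans (w₁-suc (suc K)) (e₂ (w₁-suc K) (w₀-suc K) (w₁-suc k) (w₀-suc k)))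
    (subst (_ <_) (sym (length-++ (w₁ (suc K)))) x<))
  where
  -- From 0 and from f_{2K+1}, w₁ (K+2) reads u | z u | A B A and u | u z | B A A.
  K = suc k
  u = w₁ K
  z = w₀ K
  A = w₁ k
  B = w₀ k
  e₁ : ∀ {U V u z} → U ≡ u ++ z ++ u → V ≡ u → u ≡ A ++ B ++ A → z ≡ A →
    U ++ V ≡ u ++ (z ++ u) ++ ((A ++ B) ++ A)
  e₁ refl refl refl refl = solve 2 (λ A B →
      ((A ⊕ (B ⊕ A)) ⊕ (A ⊕ (A ⊕ (B ⊕ A)))) ⊕ (A ⊕ (B ⊕ A))
    ⊜ (A ⊕ (B ⊕ A)) ⊕ ((A ⊕ (A ⊕ (B ⊕ A))) ⊕ ((A ⊕ B) ⊕ A))) refl A B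
  e₂ : ∀ {U V u z} → U ≡ u ++ z ++ u → V ≡ u → u ≡ A ++ B ++ A → z ≡ A →
    U ++ V ++ U ≡ (u ++ z) ++ (u ++ (u ++ z) ++ ((B ++ A) ++ A)) ++ u
  e₂ refl refl refl refl = solve 2 (λ A B →
      ((A ⊕ (B ⊕ A)) ⊕ (A ⊕ (A ⊕ (B ⊕ A))))
        ⊕ ((A ⊕ (B ⊕ A)) ⊕ ((A ⊕ (B ⊕ A)) ⊕ (A ⊕ (A ⊕ (B ⊕ A)))))
    ⊜ ((A ⊕ (B ⊕ A)) ⊕ A)
        ⊕ (((A ⊕ (B ⊕ A)) ⊕ (((A ⊕ (B ⊕ A)) ⊕ A) ⊕ ((B ⊕ A) ⊕ A))) ⊕ (A ⊕ (B ⊕ A)))) refl A B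
  second-pair : ∀ δ → F K + (length (z ++ u) + (δ + mid k)) ≡ δ + mid (suc K) + F K
  second-pair δ rewrite length-++ z {u} | F₀-suc k = regroup (F K) (F k) (mid k) δ
    where
    regroup : ∀ a b c d → a + ((b + a) + (d + c)) ≡ d + (a + (b + c)) + a
    regroup = solve-∀
  positions : F K + suc (mid K) ∷ F K + mid K
                ∷ F K + (length (z ++ u) + suc (mid k)) ∷ F K + (length (z ++ u) + mid k) ∷ []
            ≡ suc (mid (suc K)) ∷ mid (suc K) ∷ suc (mid (suc K)) + F K ∷ mid (suc K) + F K ∷ []
  positions = cong₂ (λ p rest → p ∷ mid (suc K) ∷ rest) (+-suc (F K) (mid K))
    (cong₂ (λ p q → p ∷ q ∷ []) (second-pair 1) (second-pair 0))

-- A record rather than a function type, so that m and p can be inferred.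
record PeriodBelow (m p : ℕ) : Set where
  constructor period
  field shift : ∀ {y} → y < m → s (p + y) ≡ s y
open PeriodBelow

period-zero : ∀ {m} → PeriodBelow m 0
period-zero = period λ _ → refl

period-≤ : ∀ {m m′ p} → m ≤ m′ → PeriodBelow m′ p → PeriodBelow m p
period-≤ m≤m′ P = period λ y< → shift P (<-≤-trans y< m≤m′)

period-+ : ∀ {m m′ p q} → PeriodBelow m p → PeriodBelow m′ q → p + m ≤ m′ → PeriodBelow m (p + q)
period-+ {p = p} {q} P Q p+m≤m′ = period λ {y} y< → begin
  s (p + q + y)    ≡⟨ cong s (shuffle p q y) ⟩
  s (q + (p + y))  ≡⟨ shift Q (<-≤-trans (+-monoʳ-< p y<) p+m≤m′) ⟩
  s (p + y)        ≡⟨ shift P y< ⟩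
  s y              ∎
  where
  open ≡-Reasoning
  shuffle : ∀ p q y → p + q + y ≡ q + (p + y)
  shuffle = solve-∀

≡-if-∉ : ∀ {A : Set} {a b : Bool} {x : A} {ms} → (a ≢ b) ⇔ (x ∈ ms) → x ∉ ms → a ≡ b
≡-if-∉ {a = a} {b = b} a≢b⇔x∈ x∉ = decidable-stable (a ≟ b) (x∉ ∘ Equivalence.to a≢b⇔x∈)

∉-below : ∀ {x m} ms → All (m ≤_) ms → x < m → x ∉ ms
∉-below (_ ∷ _)  (m≤ ∷ _)   x< (here refl) = <-irrefl refl (<-≤-trans x< m≤)
∉-below (_ ∷ ms) (_ ∷ m≤ms) x< (there x∈) = ∉-below ms m≤ms x< x∈

period-F : ∀ j → PeriodBelow (mid j) (F j)
period-F j = period λ y< → ≡-if-∉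
  (shift-F-differsAt j (<-≤-trans y< (<⇒≤ (≤-<-trans (m≤n+m (mid j) (F j)) (mid<F+F₀ (suc j))))))
  (∉-below _ (n≤1+n _ ∷ ≤-refl ∷ []) y<)

period-F+F₀ : ∀ j → PeriodBelow (mid (suc j)) (F j + F₀ j)
-- shift-F+F₀-differsAt needs a level j ≥ 1; at level 0 the claim is just s 2 = s 0.
period-F+F₀ zero    = period λ { {zero} _ → refl ; {suc _} (s≤s ()) }
period-F+F₀ (suc j) = period λ y< → ≡-if-∉
  (shift-F+F₀-differsAt j (<-trans y< (mid<F+F₀ (suc (suc j)))))
  (∉-below _ (n≤1+n _ ∷ ≤-refl ∷ ≤-trans (n≤1+n _) (m≤m+n _ _) ∷ m≤m+n _ _ ∷ []) y<)

-- ds holds the digits a_{i₀}, a_{i₀+1}, … of a representation.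
AdmissibleFrom : ℕ → List Bool → Set
AdmissibleFrom i₀ ds = ∀ i → (digit ds i ∧ digit ds (suc i) ≡ false)
                           × (isEven (i + i₀) ≡ true → digit ds i ∧ digit ds (suc (suc i)) ≡ false)

admissibleFrom-tail : ∀ {i₀ d ds} → AdmissibleFrom i₀ (d ∷ ds) → AdmissibleFrom (suc i₀) ds
admissibleFrom-tail {i₀} ad i =
  proj₁ (ad (suc i)) , proj₂ (ad (suc i)) ∘ subst (λ t → isEven t ≡ true) (+-suc i i₀)

admissibleFrom-drop : ∀ m {i₀} ds → AdmissibleFrom i₀ ds → AdmissibleFrom (m + i₀) (drop m ds)
admissibleFrom-drop zero    ds       ad = ad
admissibleFrom-drop (suc m) []       _  = λ _ → refl , λ _ → refl
admissibleFrom-drop (suc m) {i₀} (_ ∷ ds) ad =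
  subst (λ t → AdmissibleFrom t (drop m ds)) (+-suc m i₀) (admissibleFrom-drop m ds (admissibleFrom-tail ad))

admissible-drop : ∀ {a} → Admissible a → ∀ m → AdmissibleFrom m (drop m a)
admissible-drop {a} ad m = subst (λ t → AdmissibleFrom t (drop m a)) (+-identityʳ m)
  (admissibleFrom-drop m a λ i →
    proj₁ (ad i) , proj₂ (ad i) ∘ subst (λ t → isEven t ≡ true) (+-identityʳ i))

period-f-double : ∀ j → PeriodBelow (mid j) (f (double j))
period-f-double j = subst (PeriodBelow (mid j)) (sym (f-double j)) (period-F j)

period-f-suc-double : ∀ j → PeriodBelow (mid (suc j)) (f (suc (double j)))
period-f-suc-double j = subst (PeriodBelow (mid (suc j))) (sym (f-suc-double j)) (period-F+F₀ j)

tail-period-even : ∀ j ds → AdmissibleFrom (double j) ds → PeriodBelow (mid j) (val-from (double j) ds)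
tail-period-odd  : ∀ j ds → AdmissibleFrom (suc (double j)) ds →
  PeriodBelow (mid (suc j)) (val-from (suc (double j)) ds)

tail-period-even j []                          _  = period-zero
tail-period-even j (false ∷ ds)                ad =
  period-≤ (m≤n+m (mid j) (F j)) (tail-period-odd j ds (admissibleFrom-tail ad))
tail-period-even j (true ∷ [])                 _  = period-+ (period-f-double j) period-zero ≤-refl
tail-period-even j (true ∷ false ∷ [])         _  = period-+ (period-f-double j) period-zero ≤-refl
tail-period-even j (true ∷ false ∷ false ∷ ds) ad =
  period-+ (period-f-double j)
    (tail-period-odd (suc j) ds (admissibleFrom-tail (admissibleFrom-tail (admissibleFrom-tail ad))))
    (subst (λ p → p + mid j ≤ mid (suc (suc j))) (sym (f-double j)) (m≤n+m _ (F (suc j))))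
tail-period-even j (true ∷ true ∷ _)           ad = case proj₁ (ad 0) of λ ()
tail-period-even j (true ∷ false ∷ true ∷ _)   ad = case proj₂ (ad 0) (isEven-double j) of λ ()

tail-period-odd j []                  _  = period-zero
tail-period-odd j (false ∷ ds)        ad = tail-period-even (suc j) ds (admissibleFrom-tail ad)
tail-period-odd j (true ∷ [])         _  = period-+ (period-f-suc-double j) period-zero ≤-refl
tail-period-odd j (true ∷ false ∷ ds) ad =
  period-+ (period-f-suc-double j)
    (tail-period-odd (suc j) ds (admissibleFrom-tail (admissibleFrom-tail ad)))
    (subst (λ p → p + mid (suc j) ≤ mid (suc (suc j))) (sym (f-suc-double j))
      (+-monoˡ-≤ (mid (suc j)) (F+F₀≤F-suc j)))
tail-period-odd j (true ∷ true ∷ _)   ad = case proj₁ (ad 0) of λ ()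

partial-suc : ∀ m a → partial (suc m) a ≡ partial m a + (if digit a m then f m else 0)
partial-suc m a with digit a m
... | true  = refl
... | false = refl

partial-suc-true : ∀ m a → digit a m ≡ true → partial (suc m) a ≡ partial m a + f m
partial-suc-true m a d = trans (partial-suc m a) (cong (λ b → partial m a + (if b then f m else 0)) d)

partial-suc-false : ∀ m a → digit a m ≡ false → partial (suc m) a ≡ partial m a
partial-suc-false m a d =
  trans (partial-suc m a) (trans (cong (λ b → partial m a + (if b then f m else 0)) d) (+-identityʳ _))

val-from-drop : ∀ a m i →
  val-from i (drop m a) ≡ (if digit a m then f i else 0) + val-from (suc i) (drop (suc m) a)
val-from-drop []           zero    i = refl
val-from-drop []           (suc m) i = refl
val-from-drop (true ∷ _)   zero    i = refl
val-from-drop (false ∷ _)  zero    i = refl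
val-from-drop (_ ∷ ds)     (suc m) i = val-from-drop ds m i

val-from-drop-false : ∀ a m i → digit a m ≡ false →
  val-from i (drop m a) ≡ val-from (suc i) (drop (suc m) a)
val-from-drop-false a m i d =
  trans (val-from-drop a m i) (cong (λ b → (if b then f i else 0) + val-from (suc i) (drop (suc m) a)) d)

value-split : ∀ a m → value a ≡ partial m a + val-from m (drop m a)
value-split a zero    = refl
value-split a (suc m) = begin
  value a                                    ≡⟨ value-split a m ⟩
  partial m a + val-from m (drop m a)        ≡⟨ cong (partial m a +_) (val-from-drop a m m) ⟩
  partial m a + (dₘ + rest)                  ≡⟨ +-assoc (partial m a) dₘ rest ⟨
  partial m a + dₘ + rest                    ≡⟨ cong (_+ rest) (partial-suc m a) ⟨
  partial (suc m) a + rest                   ∎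
  where
  open ≡-Reasoning
  dₘ   = if digit a m then f m else 0
  rest = val-from (suc m) (drop (suc m) a)

module _ {a} (ad : Admissible a) where

  after-one : ∀ i → digit a i ≡ true → digit a (suc i) ≡ false
  after-one i d = subst (λ b → b ∧ digit a (suc i) ≡ false) d (proj₁ (ad i))

  before-one : ∀ i → digit a (suc i) ≡ true → digit a i ≡ false
  before-one i d = trans (sym (∧-identityʳ _)) (subst (λ b → digit a i ∧ b ≡ false) d (proj₁ (ad i)))

  two-after-one : ∀ i → isEven i ≡ true → digit a i ≡ true → digit a (suc (suc i)) ≡ false
  two-after-one i even d = subst (λ b → b ∧ digit a (suc (suc i)) ≡ false) d (proj₂ (ad i) even)

  two-before-one : ∀ i → isEven i ≡ true → digit a (suc (suc i)) ≡ true → digit a i ≡ false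
  two-before-one i even d =
    trans (sym (∧-identityʳ _)) (subst (λ b → digit a i ∧ b ≡ false) d (proj₂ (ad i) even))

  partial-bounds : ∀ j → partial (double j) a < F j × partial (suc (double j)) a < F j + F₀ j
  partial-bounds zero    = s≤s z≤n , s≤s (subst (_≤ 1) (sym (partial-suc 0 a)) (digit-value≤ (digit a 0)))
    where
    digit-value≤ : ∀ b → (if b then 1 else 0) ≤ 1
    digit-value≤ true  = ≤-refl
    digit-value≤ false = z≤n
  partial-bounds (suc j) = P₂<F , P₃<F+F₀
    where
    open ≤-Reasoning
    i = double j
    P<F = proj₁ (partial-bounds j)
    P₁<F+F₀ = proj₂ (partial-bounds j)
    P₂<F : partial (suc (suc i)) a < F (suc j)
    P₂<F = P₂<F-by refl
      where
      P₂<F-by : ∀ {b} → digit a (suc i) ≡ b → partial (suc (suc i)) a < F (suc j)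
      P₂<F-by {false} d₁ = begin-strict
        partial (suc (suc i)) a  ≡⟨ partial-suc-false (suc i) a d₁ ⟩
        partial (suc i) a        <⟨ P₁<F+F₀ ⟩
        F j + F₀ j               ≤⟨ F+F₀≤F-suc j ⟩
        F (suc j)                ∎
      P₂<F-by {true} d₁ = begin-strict
        partial (suc (suc i)) a        ≡⟨ partial-suc-true (suc i) a d₁ ⟩
        partial (suc i) a + f (suc i)  ≡⟨ cong₂ _+_ (partial-suc-false i a (before-one i d₁)) (f-suc-double j) ⟩
        partial i a + (F j + F₀ j)     <⟨ +-monoˡ-< (F j + F₀ j) P<F ⟩
        F j + (F j + F₀ j)             ≡⟨ cong (F j +_) (+-comm (F j) (F₀ j)) ⟩
        F j + (F₀ j + F j)             ≡⟨ F-suc j ⟨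
        F (suc j)                      ∎
    P₃<F+F₀ : partial (suc (suc (suc i))) a < F (suc j) + F₀ (suc j)
    P₃<F+F₀ = P₃<F+F₀-by refl
      where
      P₃<F+F₀-by : ∀ {b} → digit a (suc (suc i)) ≡ b →
        partial (suc (suc (suc i))) a < F (suc j) + F₀ (suc j)
      P₃<F+F₀-by {false} d₂ = begin-strict
        partial (suc (suc (suc i))) a  ≡⟨ partial-suc-false (suc (suc i)) a d₂ ⟩
        partial (suc (suc i)) a        <⟨ P₂<F ⟩
        F (suc j)                      ≤⟨ m≤m+n (F (suc j)) (F₀ (suc j)) ⟩
        F (suc j) + F₀ (suc j)         ∎
      P₃<F+F₀-by {true} d₂ = begin-strict
        partial (suc (suc (suc i))) a          ≡⟨ partial-suc-true (suc (suc i)) a d₂ ⟩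
        partial (suc (suc i)) a + f (suc (suc i))
          ≡⟨ cong₂ _+_ (trans (partial-suc-false (suc i) a (before-one (suc i) d₂))
                              (partial-suc-false i a (two-before-one i (isEven-double j) d₂)))
                       (f-double (suc j)) ⟩
        partial i a + F (suc j)                <⟨ +-monoˡ-< (F (suc j)) P<F ⟩
        F j + F (suc j)                        ≡⟨ cong (_+ F (suc j)) (F₀-suc j) ⟨
        F₀ (suc j) + F (suc j)                 ≡⟨ +-comm (F₀ (suc j)) (F (suc j)) ⟩
        F (suc j) + F₀ (suc j)                 ∎

  -- If a_{2k+2} = 0 then Φ_k < f_{2k+2} and the tail from 2k+3 has a long enough period;
  -- otherwise a_{2k+3} = a_{2k+4} = 0 and the tail from 2k+5 has an even longer one.
  high-part-period : ∀ k → let m = suc (double (suc k)) in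
    PeriodBelow (suc (partial m a + (F k + mid k))) (val-from m (drop m a))
  high-part-period k = by-digit refl
    where
    m = suc (double (suc k))
    by-digit : ∀ {b} → digit a (double (suc k)) ≡ b →
      PeriodBelow (suc (partial m a + (F k + mid k))) (val-from m (drop m a))
    by-digit {false} d = period-≤ (+-monoˡ-≤ (F k + mid k) x<F)
        (tail-period-odd (suc k) (drop m a) (admissible-drop {a} ad m))
      where
      x<F : partial m a < F (suc k)
      x<F = subst (_< F (suc k)) (sym (partial-suc-false (double (suc k)) a d))
                  (proj₁ (partial-bounds (suc k)))
    by-digit {true} d = subst (PeriodBelow _) (sym skip-zeros)
        (period-≤ (+-mono-≤ x<F (m≤n+m (F k + mid k) (F (suc k))))
          (tail-period-odd (suc (suc k)) (drop (suc (suc m)) a) (admissible-drop {a} ad (suc (suc m)))))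
      where
      x<F : partial m a < F (suc (suc k))
      x<F = <-≤-trans (proj₂ (partial-bounds (suc k))) (F+F₀≤F-suc (suc k))
      skip-zeros : val-from m (drop m a) ≡ val-from (suc (suc m)) (drop (suc (suc m)) a)
      skip-zeros = trans (val-from-drop-false a m m (after-one (double (suc k)) d))
                         (val-from-drop-false a (suc m) (suc m)
                           (two-after-one (double (suc k)) (isEven-double (suc k)) d))

Φ≡partial : ∀ k a → Φ k a ≡ partial (suc (double (suc k))) a
Φ≡partial k a = cong (λ i → partial (3 + i) a) (sym (double≡2* k))

Φ<F+F₀ : ∀ {a} → Admissible a → ∀ k → Φ k a < F (suc k) + F₀ (suc k)
Φ<F+F₀ {a} ad k =
  subst (_< F (suc k) + F₀ (suc k)) (sym (Φ≡partial k a)) (proj₂ (partial-bounds ad (suc k)))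

shift-truncation : ∀ {n a} → IsFRep n a → ∀ k {c} → c ≤ F k + mid k →
  (s (n + c) ≢ s n) ⇔ (s (c + Φ k a) ≢ s (Φ k a))
shift-truncation {n} {a} (value≡n , ad) k {c} c≤ = ≢-cong
  (begin
    s (n + c)        ≡⟨ cong (λ t → s (t + c)) n≡x+H ⟩
    s (x + H + c)    ≡⟨ cong s (shuffle x H c) ⟩
    s (H + (c + x))  ≡⟨ shift H-period (s≤s (subst (_≤ x + (F k + mid k)) (+-comm x c) (+-monoʳ-≤ x c≤))) ⟩
    s (c + x)        ≡⟨ cong (λ t → s (c + t)) (Φ≡partial k a) ⟨
    s (c + Φ k a)    ∎)
  (begin
    s n              ≡⟨ cong s (trans n≡x+H (+-comm x H)) ⟩
    s (H + x)        ≡⟨ shift H-period (s≤s (m≤m+n x (F k + mid k))) ⟩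
    s x              ≡⟨ cong s (Φ≡partial k a) ⟨
    s (Φ k a)        ∎)
  where
  open ≡-Reasoning
  m = suc (double (suc k))
  x = partial m a
  H = val-from m (drop m a)
  H-period = high-part-period ad k
  n≡x+H : n ≡ x + H
  n≡x+H = trans (sym value≡n) (value-split a m)
  shuffle : ∀ x H c → x + H + c ≡ H + (c + x)
  shuffle = solve-∀

∈-pair⇔ : ∀ {A : Set} {x a b : A} → x ∈ a ∷ b ∷ [] ⇔ (x ≡ a ⊎ x ≡ b)
∈-pair⇔ = mk⇔ (λ { (here e) → inj₁ e ; (there (here e)) → inj₂ e })
              (λ { (inj₁ e) → here e ; (inj₂ e) → there (here e) })

∈-quad⇔ : ∀ {A : Set} {x a b c d : A} → x ∈ a ∷ b ∷ c ∷ d ∷ [] ⇔ (x ≡ a ⊎ x ≡ b ⊎ x ≡ c ⊎ x ≡ d)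
∈-quad⇔ = mk⇔
  (λ { (here e)                     → inj₁ e
     ; (there (here e))               → inj₂ (inj₁ e)
     ; (there (there (here e)))       → inj₂ (inj₂ (inj₁ e))
     ; (there (there (there (here e)))) → inj₂ (inj₂ (inj₂ e)) })
  (λ { (inj₁ e)               → here e
     ; (inj₂ (inj₁ e))        → there (here e)
     ; (inj₂ (inj₂ (inj₁ e))) → there (there (here e))
     ; (inj₂ (inj₂ (inj₂ e))) → there (there (there (here e))) })

theorem4 : (n : ℕ) → (a : List Bool) → IsFRep n a →
    ((k : ℕ) →
      (s (n + f (2 * k)) ≢ s n)
        ⇔ (Φ k a ≡ f (2 * k + 1) / 2 ⊎ Φ k a ≡ f (2 * k + 1) / 2 ∸ 1))
    × ((k : ℕ) → 1 ≤ k →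
      (s (n + f (2 * k + 1)) ≢ s n)
        ⇔ (Φ k a ≡ f (2 * k + 3) / 2 ⊎ Φ k a ≡ f (2 * k + 3) / 2 ∸ 1
           ⊎ Φ k a ≡ f (2 * k + 3) / 2 + f (2 * k)
           ⊎ Φ k a ≡ f (2 * k + 3) / 2 + f (2 * k) ∸ 1))
theorem4 n a rep = part-i , part-ii
  where
  part-i : ∀ k → (s (n + f (2 * k)) ≢ s n)
    ⇔ (Φ k a ≡ f (2 * k + 1) / 2 ⊎ Φ k a ≡ f (2 * k + 1) / 2 ∸ 1)
  part-i k rewrite f-2* k | f-2*+1/2 k =
    ⇔-trans (shift-truncation rep k (m≤m+n (F k) (mid k)))
      (⇔-trans (shift-F-differsAt k (Φ<F+F₀ (proj₂ rep) k)) ∈-pair⇔)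
  part-ii : ∀ k → 1 ≤ k → (s (n + f (2 * k + 1)) ≢ s n)
    ⇔ (Φ k a ≡ f (2 * k + 3) / 2 ⊎ Φ k a ≡ f (2 * k + 3) / 2 ∸ 1
       ⊎ Φ k a ≡ f (2 * k + 3) / 2 + f (2 * k)
       ⊎ Φ k a ≡ f (2 * k + 3) / 2 + f (2 * k) ∸ 1)
  part-ii (suc k) _ rewrite f-2*+1 (suc k) | f-2*+3/2 (suc k) | f-2* (suc k) =
    ⇔-trans (shift-truncation rep (suc k) (+-monoʳ-≤ (F (suc k)) F₀≤mid))
      (⇔-trans (shift-F+F₀-differsAt k (Φ<F+F₀ (proj₂ rep) (suc k))) ∈-quad⇔)
    where
    F₀≤mid : F₀ (suc k) ≤ mid (suc k)
    F₀≤mid = subst (_≤ mid (suc k)) (sym (F₀-suc k)) (m≤m+n (F k) (mid k))
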